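{- Let T1 be the Hilbert system described in the context. Then $\vdash_{T1} \forall x\,\forall y.\ [x=x]=[y=y]$.
   Context: The language $L^\omega$ has countably many variables, countably many $n$-ary predicate symbols including a distinguished binary predicate $=$, connectives $\&,\sim$, the quantifier $\exists$ (with $\rightarrow,\leftrightarrow,\vee,\forall$ defined as usual), and an intensional abstraction operator. Terms and formulas are defined simultaneously: variables are terms; if $t_1,\dots,t_n$ are terms and $F$ is $n$-ary then $F(t_1,\dots,t_n)$ is a formula; if $A,B$ are formulas and $v$ a variable then $(A\&B)$, $\sim A$, $\exists v. A$ are formulas; if $A$ is a formula and $v_1,\dots,v_m$ ($m\ge 0$) are distinct variables then $[A]_{v_1\dots v_m}$ is a term (variables $v_i$ are bound in it); write $[A]$ when $m=0$. Define $\square A :\equiv [A] = [[A]=[A]]$ and $\lozenge A :\equiv \sim\square\sim A$. The system T1 has the axioms: all tautologies; (Ins) $\forall v. A(v)\rightarrow A(t)$ for $t$ free for $v$ in $A$; (QImp) $\forall v.(A\rightarrow B)\rightarrow(A\rightarrow\forall v. B)$ for $v$ not free in $A$; (Id) $v=v$; (L) $v=w\rightarrow(A(v,v)\leftrightarrow A(v,w))$, where $A(v,w)$ results from $A(v,v)$ by replacing some free occurrences of $v$ by $w$, $w$ being free for $v$ at those positions; $\sim [A]_{\bar x}=[B]_{\bar y}$ whenever $\bar x,\bar y$ have different lengths; $[A]_{\bar x}=[A']_{\bar x'}$ whenever these are alphabetic variants ($\alpha$-equivalence); (B) $[A]_{\bar x}=[B]_{\bar x}\leftrightarrow\square\forall\bar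 x.(A\leftrightarrow B)$; (T) $\square A\rightarrow A$; (K) $\square(A\rightarrow B)\rightarrow(\square A\rightarrow\square B)$; (S5) $\lozenge A\rightarrow\square\lozenge A$. Rules: (MP) from $A$ and $A\rightarrow B$ infer $B$; (N) from $A$ infer $\square A$; (Gen) from $A$ infer $\forall v. A$. -}

module Defs where

open import Data.Nat using (ℕ)
open import Data.Fin using (Fin)
open import Data.Bool using (Bool; true; false; _∧_; not)
open import Data.List using (List; []; _∷_; _++_; length; zip; foldr)
open import Data.List.Membership.Propositional using (_∈_; _∉_)
open import Data.List.Relation.Unary.Unique.Propositional using (Unique)
open import Data.Product using (_×_; _,_)
open import Relation.Binary.PropositionalEquality using (_≡_; _≢_)
open import Relation.Nullary using (¬_)

-- For each arity n there
-- are countably many n-ary predicate symbols (indexed by ℕ), plus the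
-- distinguished binary predicate '=' (constructor _≐_).
-- An abstract [A]_{v1..vm} carries a proof that the vi are distinct.

data Term : Set
data Formula : Set

data Term where
  var : ℕ → Term
  abs : Formula → (xs : List ℕ) → Unique xs → Term

data Formula where
  pred : (n : ℕ) → ℕ → (Fin n → Term) → Formula
  _≐_  : Term → Term → Formula
  _&_  : Formula → Formula → Formula
  ~_   : Formula → Formula
  ex   : ℕ → Formula → Formula

infix 6 _≐_
infixr 5 _&_
infix 7 ~_

_⇒_ : Formula → Formula → Formula
A ⇒ B = ~ (A & ~ B)

_⇔_ : Formula → Formula → Formula
A ⇔ B = (A ⇒ B) & (B ⇒ A)

infixr 4 _⇒_
infix 3 _⇔_

all : ℕ → Formula → Formula
all v A = ~ ex v (~ A)

allL : List ℕ → Formula → Formula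
allL xs A = foldr all A xs

[_] : Formula → Term
[ A ] = abs A [] Unique.[]

□ : Formula → Formula
□ A = [ A ] ≐ [ [ A ] ≐ [ A ] ]

◇ : Formula → Formula
◇ A = ~ □ (~ A)

data FreeT (u : ℕ) : Term → Set
data FreeF (u : ℕ) : Formula → Set

data FreeT u where
  fv-var : FreeT u (var u)
  fv-abs : ∀ {A xs p} → u ∉ xs → FreeF u A → FreeT u (abs A xs p)

data FreeF u where
  fv-pred : ∀ {n P ts} (i : Fin n) → FreeT u (ts i) → FreeF u (pred n P ts)
  fv-≐₁  : ∀ {s t} → FreeT u s → FreeF u (s ≐ t)
  fv-≐₂  : ∀ {s t} → FreeT u t → FreeF u (s ≐ t)
  fv-&₁  : ∀ {A B} → FreeF u A → FreeF u (A & B)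
  fv-&₂  : ∀ {A B} → FreeF u B → FreeF u (A & B)
  fv-~   : ∀ {A} → FreeF u A → FreeF u (~ A)
  fv-ex  : ∀ {v A} → u ≢ v → FreeF u A → FreeF u (ex v A)

-- SubT Γ v t s s' : Γ is the list of variables bound at the current
-- position; s' is s[t/v].  The relation holds only if no free variable
-- of t gets captured at a replaced occurrence (i.e. "t free for v").

data SubT (Γ : List ℕ) (v : ℕ) (t : Term) : Term → Term → Set
data SubF (Γ : List ℕ) (v : ℕ) (t : Term) : Formula → Formula → Set

data SubT Γ v t where
  s-hit  : v ∉ Γ → (∀ u → FreeT u t → u ∉ Γ) → SubT Γ v t (var v) t
  s-bound : v ∈ Γ → SubT Γ v t (var v) (var v)
  s-other : ∀ {u} → u ≢ v → SubT Γ v t (var u) (var u)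
  s-abs  : ∀ {A A' xs p} → SubF (xs ++ Γ) v t A A' → SubT Γ v t (abs A xs p) (abs A' xs p)

data SubF Γ v t where
  s-pred : ∀ {n P ts ts'} → (∀ i → SubT Γ v t (ts i) (ts' i)) → SubF Γ v t (pred n P ts) (pred n P ts')
  s-≐    : ∀ {a a' b b'} → SubT Γ v t a a' → SubT Γ v t b b' → SubF Γ v t (a ≐ b) (a' ≐ b')
  s-&    : ∀ {A A' B B'} → SubF Γ v t A A' → SubF Γ v t B B' → SubF Γ v t (A & B) (A' & B')
  s-~    : ∀ {A A'} → SubF Γ v t A A' → SubF Γ v t (~ A) (~ A')
  s-ex   : ∀ {u A A'} → SubF (u ∷ Γ) v t A A' → SubF Γ v t (ex u A) (ex u A')

-- ReplF Γ v w A B : B results from A by replacing some (possibly none)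
-- free occurrences of v by w, w being free for v at those positions.

data ReplT (Γ : List ℕ) (v w : ℕ) : Term → Term → Set
data ReplF (Γ : List ℕ) (v w : ℕ) : Formula → Formula → Set

data ReplT Γ v w where
  r-keep : ∀ {u} → ReplT Γ v w (var u) (var u)
  r-swap : v ∉ Γ → w ∉ Γ → ReplT Γ v w (var v) (var w)
  r-abs  : ∀ {A A' xs p} → ReplF (xs ++ Γ) v w A A' → ReplT Γ v w (abs A xs p) (abs A' xs p)

data ReplF Γ v w where
  r-pred : ∀ {n P ts ts'} → (∀ i → ReplT Γ v w (ts i) (ts' i)) → ReplF Γ v w (pred n P ts) (pred n P ts')
  r-≐    : ∀ {a a' b b'} → ReplT Γ v w a a' → ReplT Γ v w b b' → ReplF Γ v w (a ≐ b) (a' ≐ b')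
  r-&    : ∀ {A A' B B'} → ReplF Γ v w A A' → ReplF Γ v w B B' → ReplF Γ v w (A & B) (A' & B')
  r-~    : ∀ {A A'} → ReplF Γ v w A A' → ReplF Γ v w (~ A) (~ A')
  r-ex   : ∀ {u A A'} → ReplF (u ∷ Γ) v w A A' → ReplF Γ v w (ex u A) (ex u A')

-- Alphabetic variants (α-equivalence).  ρ is a stack of pairs of
-- corresponding bound variables (innermost first).

data AlphaT : List (ℕ × ℕ) → Term → Term → Set
data AlphaF : List (ℕ × ℕ) → Formula → Formula → Set

data AlphaT where
  a-free  : ∀ {u} → AlphaT [] (var u) (var u)
  a-here  : ∀ {ρ u u'} → AlphaT ((u , u') ∷ ρ) (var u) (var u')
  a-there : ∀ {ρ x x' u u'} → u ≢ x → u' ≢ x' → AlphaT ρ (var u) (var u') →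
            AlphaT ((x , x') ∷ ρ) (var u) (var u')
  a-abs   : ∀ {ρ A A' xs xs' p p'} → length xs ≡ length xs' →
            AlphaF (zip xs xs' ++ ρ) A A' → AlphaT ρ (abs A xs p) (abs A' xs' p')

data AlphaF where
  a-pred : ∀ {ρ n P ts ts'} → (∀ i → AlphaT ρ (ts i) (ts' i)) → AlphaF ρ (pred n P ts) (pred n P ts')
  a-≐    : ∀ {ρ a a' b b'} → AlphaT ρ a a' → AlphaT ρ b b' → AlphaF ρ (a ≐ b) (a' ≐ b')
  a-&    : ∀ {ρ A A' B B'} → AlphaF ρ A A' → AlphaF ρ B B' → AlphaF ρ (A & B) (A' & B')
  a-~    : ∀ {ρ A A'} → AlphaF ρ A A' → AlphaF ρ (~ A) (~ A')
  a-ex   : ∀ {ρ v v' A A'} → AlphaF ((v , v') ∷ ρ) A A' → AlphaF ρ (ex v A) (ex v' A')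

-- Tautologies: true under every truth assignment to prime formulas
-- (atomic formulas and ∃-formulas), & and ~ read truth-functionally.

eval : (Formula → Bool) → Formula → Bool
eval val (A & B) = eval val A ∧ eval val B
eval val (~ A)   = not (eval val A)
eval val A       = val A

Tautology : Formula → Set
Tautology A = ∀ (val : Formula → Bool) → eval val A ≡ true

data ⊢_ : Formula → Set where
  taut  : ∀ {A} → Tautology A → ⊢ A
  ins   : ∀ {v t A B} → SubF [] v t A B → ⊢ (all v A ⇒ B)
  qimp  : ∀ {v A B} → ¬ FreeF v A → ⊢ (all v (A ⇒ B) ⇒ (A ⇒ all v B))
  id≐   : ∀ {v} → ⊢ (var v ≐ var v)
  leib  : ∀ {v w A B} → ReplF [] v w A B → ⊢ (var v ≐ var w ⇒ (A ⇔ B))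
  arity : ∀ {A B xs ys p q} → length xs ≢ length ys → ⊢ (~ (abs A xs p ≐ abs B ys q))
  alpha : ∀ {A A' xs xs' p p'} → AlphaT [] (abs A xs p) (abs A' xs' p') →
          ⊢ (abs A xs p ≐ abs A' xs' p')
  axB   : ∀ {A B xs p} → ⊢ (abs A xs p ≐ abs B xs p ⇔ □ (allL xs (A ⇔ B)))
  axT   : ∀ {A} → ⊢ (□ A ⇒ A)
  axK   : ∀ {A B} → ⊢ (□ (A ⇒ B) ⇒ (□ A ⇒ □ B))
  axS5  : ∀ {A} → ⊢ (◇ A ⇒ □ (◇ A))
  mp    : ∀ {A B} → ⊢ A → ⊢ (A ⇒ B) → ⊢ B
  nec   : ∀ {A} → ⊢ A → ⊢ □ A
  gen   : ∀ {v A} → ⊢ A → ⊢ all v A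

infix 2 ⊢_

module Submission where

open import Defs
open import Data.Nat using (ℕ)
open import Data.List using (List)
open import Data.List.Relation.Unary.Unique.Propositional using (Unique)
open import Data.Bool using (true; false)
open import Relation.Binary.PropositionalEquality using (_≢_; refl)

-- By axiom (B), [A]_x̄ = [B]_x̄ follows from □ ∀x̄. (A ↔ B), which necessitation
-- yields from any proof of ∀x̄. (A ↔ B).  Both x = x and y = y are instances of
-- (Id), so they are provably equivalent and their propositions [x = x] and
-- [y = y] coincide; generalising over x and y gives the theorem.

⇔-intro-taut : ∀ A B → Tautology (A ⇒ (B ⇒ (A ⇔ B)))
⇔-intro-taut A B val with eval val A | eval val B
... | true  | true  = refl
... | true  | false = refl
... | false | true  = refl
... | false | false = refl

⇔-elimˡ-taut : ∀ A B → Tautology ((A ⇔ B) ⇒ (B ⇒ A))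
⇔-elimˡ-taut A B val with eval val A | eval val B
... | true  | true  = refl
... | true  | false = refl
... | false | true  = refl
... | false | false = refl

⇔-intro : ∀ {A B} → ⊢ A → ⊢ B → ⊢ (A ⇔ B)
⇔-intro {A} {B} ⊢A ⊢B = mp ⊢B (mp ⊢A (taut (⇔-intro-taut A B)))

⇔-elimˡ : ∀ {A B} → ⊢ (A ⇔ B) → ⊢ B → ⊢ A
⇔-elimˡ {A} {B} ⊢A⇔B ⊢B = mp ⊢B (mp ⊢A⇔B (taut (⇔-elimˡ-taut A B)))

abs-cong : ∀ {A B} {xs : List ℕ} {p : Unique xs} →
           ⊢ allL xs (A ⇔ B) → ⊢ (abs A xs p ≐ abs B xs p)
abs-cong ⊢A⇔B = ⇔-elimˡ axB (nec ⊢A⇔B)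

lemma1p27 : (x y : ℕ) → x ≢ y →
    ⊢ all x (all y ([ var x ≐ var x ] ≐ [ var y ≐ var y ]))
lemma1p27 x y _ = gen (gen (abs-cong (⇔-intro id≐ id≐)))
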